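{- Let $G=H^2$ for some graph $H$ containing no cycle of length $3$ and no cycle of length $5$. Then for every vertex $x$ and every vertex $y\in N_H(x)$, $$N_H(y)=N_G(y)\cap\big(N_G[x]\setminus N_H(x)\big).$$
   Context: All graphs are finite, undirected and simple. For a graph $H$, $H^2$ is the graph on the same vertex set in which two distinct vertices are adjacent iff their distance in $H$ is at most $2$. $N_G(v)$ denotes the neighbourhood of $v$ in $G$ and $N_G[v]=N_G(v)\cup\{v\}$. -}

module Defs where

open import Data.Nat using (ℕ; suc)
open import Data.Fin using (Fin; zero; suc; inject₁; fromℕ)
open import Data.Product using (Σ; ∃; _×_; _,_; proj₁)
open import Data.Sum using (_⊎_; inj₁; inj₂)
open import Data.Empty using (⊥)
open import Relation.Nullary using (¬_)
open import Relation.Binary.PropositionalEquality using (_≡_; _≢_; refl; sym)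
open import Function.Definitions using (Injective)

record Graph (n : ℕ) : Set₁ where
  field
    Adj        : Fin n → Fin n → Set
    Adj-sym    : ∀ {u v} → Adj u v → Adj v u
    Adj-irrefl : ∀ {u} → ¬ Adj u u
open Graph public

N : ∀ {n} → Graph n → Fin n → Fin n → Set
N H v z = Adj H v z

N[_] : ∀ {n} → Graph n → Fin n → Fin n → Set
N[ H ] v z = (z ≡ v) ⊎ Adj H v z

Adj² : ∀ {n} → Graph n → Fin n → Fin n → Set
Adj² H u v = u ≢ v × (Adj H u v ⊎ ∃ λ w → Adj H u w × Adj H w v)

Adj²-sym : ∀ {n} (H : Graph n) {u v} → Adj² H u v → Adj² H v u
Adj²-sym H (ne , inj₁ a) = (λ e → ne (sym e)) , inj₁ (Adj-sym H a)
Adj²-sym H (ne , inj₂ (w , a , b)) = (λ e → ne (sym e)) , inj₂ (w , Adj-sym H b , Adj-sym H a)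

Square : ∀ {n} → Graph n → Graph n
Square H = record
  { Adj = Adj² H
  ; Adj-sym = Adj²-sym H
  ; Adj-irrefl = λ p → proj₁ p refl }

Cycle : ∀ {n} → Graph n → ℕ → Set
Cycle H 0 = ⊥
Cycle {n} H (suc m) =
  Σ (Fin (suc m) → Fin n) λ f →
    Injective _≡_ _≡_ f
    × (∀ (i : Fin m) → Adj H (f (inject₁ i)) (f (suc i)))
    × Adj H (f (fromℕ m)) (f zero)

-- If x ~ y and z is an H²-neighbour of both y and x, then z is reached from y
-- either directly or through a path y w z; closing it with a path of length at
-- most two from z back to x gives a closed walk of length at most five through
-- the edge x y.  Without 3- and 5-cycles such a walk must degenerate, which
-- forces y ~ z unless z is a genuine H-neighbour of x.  Conversely y ~ z puts z
-- within distance two of x, and x ~ z would close a triangle.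
module Submission where

open import Defs
open import Data.Nat using (suc)
open import Data.Fin using (Fin; zero; suc; inject₁; fromℕ; _≟_)
open import Data.Vec using (Vec; []; _∷_; lookup)
open import Data.Vec.Relation.Unary.All using ([]; _∷_)
open import Data.Vec.Relation.Unary.AllPairs using ([]; _∷_)
open import Data.Vec.Relation.Unary.Linked using (Linked; [-]; _∷_)
open import Data.Vec.Relation.Unary.Unique.Propositional using (Unique)
open import Data.Vec.Relation.Unary.Unique.Propositional.Properties using (lookup-injective)
open import Data.Product using (_×_; _,_)
open import Data.Sum using (_⊎_; inj₁; inj₂)
open import Data.Empty using (⊥-elim)
open import Relation.Binary.Core using (Rel)
open import Relation.Nullary using (¬_; yes; no)
open import Relation.Binary.PropositionalEquality using (_≡_; _≢_; refl; ≢-sym)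
open import Function.Bundles using (_⇔_; mk⇔)

Linked⇒lookup-suc : ∀ {a ℓ} {A : Set a} {R : Rel A ℓ} {m} {xs : Vec A (suc m)} →
  Linked R xs → ∀ (i : Fin m) → R (lookup xs (inject₁ i)) (lookup xs (suc i))
Linked⇒lookup-suc {xs = _ ∷ _ ∷ _} (r ∷ _) zero = r
Linked⇒lookup-suc (_ ∷ rs) (suc i)                    = Linked⇒lookup-suc rs i

module _ {n} (H : Graph n) where

  Adj⇒≢ : ∀ {u v} → Adj H u v → u ≢ v
  Adj⇒≢ uv refl = Adj-irrefl H uv

  closedPath⇒Cycle : ∀ {m} (vs : Vec (Fin n) (suc m)) → Unique vs →
    Linked (Adj H) vs → Adj H (lookup vs (fromℕ m)) (lookup vs zero) →
    Cycle H (suc m)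
  closedPath⇒Cycle vs unique path closing =
    lookup vs , lookup-injective unique _ _ , Linked⇒lookup-suc path , closing

  triangle⇒Cycle₃ : ∀ {a b c} → Adj H a b → Adj H b c → Adj H c a → Cycle H 3
  triangle⇒Cycle₃ ab bc ca =
    closedPath⇒Cycle (_ ∷ _ ∷ _ ∷ [])
      ((Adj⇒≢ ab ∷ ≢-sym (Adj⇒≢ ca) ∷ []) ∷ (Adj⇒≢ bc ∷ []) ∷ [] ∷ [])
      (ab ∷ bc ∷ [-]) ca

  pentagon⇒Cycle₅ : ∀ {a b c d e} →
    Adj H a b → Adj H b c → Adj H c d → Adj H d e → Adj H e a →
    a ≢ c → b ≢ d → c ≢ e → d ≢ a → e ≢ b → Cycle H 5
  pentagon⇒Cycle₅ ab bc cd de ea a≢c b≢d c≢e d≢a e≢b =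
    closedPath⇒Cycle (_ ∷ _ ∷ _ ∷ _ ∷ _ ∷ [])
      ( (Adj⇒≢ ab ∷ a≢c ∷ ≢-sym d≢a ∷ ≢-sym (Adj⇒≢ ea) ∷ [])
      ∷ (Adj⇒≢ bc ∷ b≢d ∷ ≢-sym e≢b ∷ [])
      ∷ (Adj⇒≢ cd ∷ c≢e ∷ [])
      ∷ (Adj⇒≢ de ∷ [])
      ∷ [] ∷ [])
      (ab ∷ bc ∷ cd ∷ de ∷ [-]) ea

  -- The two non-adjacent positions x, z of the walk x y w z u x are distinct,
  -- as are y, z; the only remaining coincidences are u ≡ y, w ≡ x and w ≡ u,
  -- and the last one closes the triangle x y u.
  closedWalk₅-collapses : ¬ Cycle H 3 → ¬ Cycle H 5 → ∀ {x y w z u} →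
    Adj H x y → Adj H y w → Adj H w z → Adj H z u → Adj H u x →
    x ≢ z → y ≢ z → u ≡ y ⊎ w ≡ x
  closedWalk₅-collapses no3 no5 {x} {y} {w} {z} {u} xy yw wz zu ux x≢z y≢z
    with u ≟ y | w ≟ x | w ≟ u
  ... | yes u≡y | _        | _        = inj₁ u≡y
  ... | no _    | yes w≡x  | _        = inj₂ w≡x
  ... | no _    | no _     | yes refl = ⊥-elim (no3 (triangle⇒Cycle₃ xy yw ux))
  ... | no u≢y  | no w≢x   | no w≢u   =
    ⊥-elim (no5 (pentagon⇒Cycle₅ xy yw wz zu ux (≢-sym w≢x) y≢z w≢u (≢-sym x≢z) u≢y))

lemma3p1 : ∀ {n} (H : Graph n) → ¬ Cycle H 3 → ¬ Cycle H 5 →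
    ∀ (x y : Fin n) → N H x y → ∀ (z : Fin n) →
    (N H y z ⇔ (N (Square H) y z × (N[ Square H ] x z × ¬ N H x z)))
lemma3p1 H no3 no5 x y xy z = mk⇔ forward backward
  where
  forward : Adj H y z → Adj² H y z × (N[ Square H ] x z × ¬ Adj H x z)
  forward yz = (Adj⇒≢ H yz , inj₁ yz) , near-x , λ xz → no3 (triangle⇒Cycle₃ H xy yz (Adj-sym H xz))
    where
    near-x : N[ Square H ] x z
    near-x with z ≟ x
    ... | yes z≡x = inj₁ z≡x
    ... | no z≢x  = inj₂ (≢-sym z≢x , inj₂ (y , xy , yz))

  backward : Adj² H y z × (N[ Square H ] x z × ¬ Adj H x z) → Adj H y z
  backward ((_ , inj₁ yz) , _) = yz
  backward ((_ , inj₂ _) , inj₁ refl , _) = Adj-sym H xy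
  backward ((_ , inj₂ _) , inj₂ (_ , inj₁ xz) , x≁z) = ⊥-elim (x≁z xz)
  backward ((y≢z , inj₂ (w , yw , wz)) , inj₂ (x≢z , inj₂ (u , xu , uz)) , x≁z)
    with closedWalk₅-collapses H no3 no5 xy yw wz (Adj-sym H uz) (Adj-sym H xu) x≢z y≢z
  ... | inj₁ refl = uz
  ... | inj₂ refl = ⊥-elim (x≁z wz)
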